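{- Let $r,b\in(0,1)$, $\alpha:=\min\{r,b\}$, and let $\nu<\alpha/16$ and $\delta\le\alpha/16$ be positive reals. Let $F\subseteq K$ be an $(r,b,\delta)$-regular, $(b+r,\delta)$-jumbled bipartite blue-red graph. If sets $X\subseteq V_i$, $Y\subseteq V_{3-i}$ ($i\in\{1,2\}$) satisfy $$\varepsilon_B(X,\overline Y)+\varepsilon_R(\overline X,Y)\le\nu\qquad\text{and}\qquad\min\{b\,s(X),r\,s(Y)\}\le\frac{rb}{r+b},$$ then $$\max\{b\,s(X),r\,s(Y)\}\le\frac{\nu}{1-7\delta/\alpha}.$$
   Context: $K=K_{n_1,n_2}$ is the complete bipartite graph with parts $V_1,V_2$, $|V_i|=n_i$, $N=n_1n_2$. A blue-red graph is a graph $F\subseteq K$ whose edges are colored blue or red; $B$ and $R$ denote its blue and red subgraphs. For $S\subseteq V_i$: $s(S)=|S|/n_i$ and $\overline S=V_i\setminus S$. For $X\subseteq V_1$, $Y\subseteq V_2$ and a graph $F'$: $\varepsilon_{F'}(X,Y)=\varepsilon_{F'}(Y,X)=e_{F'}(X,Y)/(n_1n_2)$, where $e_{F'}(X,Y)$ is the number of edges of $F'$ between $X$ and $Y$. For $v\in V_i$, the relative degree is $d_{F'}(v)=\deg_{F'}(v)/n_{3-i}$. $F$ is $(r,b,\delta)$-regular if $b-\delta\le d_B(v)\le b+\delta$ and $r-\delta\le d_R(v)\le r+\delta$ for every $v\in V_1\cup V_2$. $F$ is $(\pi,\delta)$-jumbled if $|e_F(A,B')-\pi|A||B'||\le\delta\sqrt{N|A||B'|}$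 for all $A\subseteq V_1$, $B'\subseteq V_2$.
   Formalization: The parameters r, b, ν and δ range over the rationals instead of the reals. -}

module Defs where

open import Data.Nat as ℕ using (ℕ; NonZero)
open import Data.Fin using (Fin; zero; suc)
open import Data.Bool using (Bool; true; false; if_then_else_; _∧_; not)
open import Data.Integer using (+_)
open import Data.Rational using (ℚ; _/_; _+_; _-_; _*_; _≤_; _<_; _⊓_; _⊔_; 0ℚ; 1ℚ)
open import Data.Product using (_×_)
open import Data.Nat.Properties using (m*n≢0)

Σ : (n : ℕ) → (Fin n → ℕ) → ℕ
Σ ℕ.zero f = 0
Σ (ℕ.suc n) f = f zero ℕ.+ Σ n (λ i → f (suc i))

Subset : ℕ → Set
Subset n = Fin n → Bool

∁ : ∀ {n} → Subset n → Subset n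
∁ S v = not (S v)

size : ∀ {n} → Subset n → ℕ
size {n} S = Σ n (λ v → if S v then 1 else 0)

s : ∀ {n} .{{_ : NonZero n}} → Subset n → ℚ
s {n} S = (+ size S) / n

data Colour : Set where
  none blue red : Colour

-- a blue-red graph F ⊆ K_{n1,n2}  (V1 = Fin n1, V2 = Fin n2)
BlueRed : ℕ → ℕ → Set
BlueRed n₁ n₂ = Fin n₁ → Fin n₂ → Colour

isBlue isRed isEdge : Colour → Bool
isBlue blue = true
isBlue _    = false
isRed red = true
isRed _   = false
isEdge none = false
isEdge _    = true

data Sub : Set where
  𝐁 𝐑 𝐅 : Sub

sel : Sub → Colour → Bool
sel 𝐁 = isBlue
sel 𝐑 = isRed
sel 𝐅 = isEdge

e : ∀ {n₁ n₂} → BlueRed n₁ n₂ → Sub → Subset n₁ → Subset n₂ → ℕ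
e {n₁} {n₂} F H X Y =
  Σ n₁ (λ u → Σ n₂ (λ w → if X u ∧ (Y w ∧ sel H (F u w)) then 1 else 0))

-- ε_{F'}(X,Y) = ε_{F'}(Y,X) = e_{F'}(X,Y) / (n1 n2),  X ⊆ V1, Y ⊆ V2
ε : ∀ {n₁ n₂} .{{_ : NonZero n₁}} .{{_ : NonZero n₂}} →
    BlueRed n₁ n₂ → Sub → Subset n₁ → Subset n₂ → ℚ
ε {n₁} {n₂} {{p}} {{q}} F H X Y =
  _/_ (+ e F H X Y) (n₁ ℕ.* n₂) {{m*n≢0 n₁ n₂ {{p}} {{q}}}}

deg₁ : ∀ {n₁ n₂} → BlueRed n₁ n₂ → Sub → Fin n₁ → ℕ
deg₁ {n₁} {n₂} F H u = Σ n₂ (λ w → if sel H (F u w) then 1 else 0)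

deg₂ : ∀ {n₁ n₂} → BlueRed n₁ n₂ → Sub → Fin n₂ → ℕ
deg₂ {n₁} {n₂} F H w = Σ n₁ (λ u → if sel H (F u w) then 1 else 0)

d₁ : ∀ {n₁ n₂} .{{_ : NonZero n₂}} → BlueRed n₁ n₂ → Sub → Fin n₁ → ℚ
d₁ {n₁} {n₂} F H u = (+ deg₁ F H u) / n₂

d₂ : ∀ {n₁ n₂} .{{_ : NonZero n₁}} → BlueRed n₁ n₂ → Sub → Fin n₂ → ℚ
d₂ {n₁} {n₂} F H w = (+ deg₂ F H w) / n₁

Regular : ∀ {n₁ n₂} .{{_ : NonZero n₁}} .{{_ : NonZero n₂}} →
          BlueRed n₁ n₂ → ℚ → ℚ → ℚ → Set
Regular F r b δ =
  (∀ u → (b - δ ≤ d₁ F 𝐁 u × d₁ F 𝐁 u ≤ b + δ) ×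
         (r - δ ≤ d₁ F 𝐑 u × d₁ F 𝐑 u ≤ r + δ)) ×
  (∀ w → (b - δ ≤ d₂ F 𝐁 w × d₂ F 𝐁 w ≤ b + δ) ×
         (r - δ ≤ d₂ F 𝐑 w × d₂ F 𝐑 w ≤ r + δ))

-- (π,δ)-jumbled:  |e_F(A,B') - π|A||B'|| ≤ δ √(N |A| |B'|), written (for δ ≥ 0)
-- in the equivalent squared form  (e_F(A,B') - π|A||B'|)² ≤ δ² N |A||B'|
Jumbled : ∀ {n₁ n₂} → BlueRed n₁ n₂ → ℚ → ℚ → Set
Jumbled {n₁} {n₂} F π δ =
  ∀ (A : Subset n₁) (B' : Subset n₂) →
    let a  = (+ size A) / 1
        b' = (+ size B') / 1
        N  = (+ (n₁ ℕ.* n₂)) / 1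
        D  = (+ e F 𝐅 A B') / 1 - π * a * b'
    in D * D ≤ δ * δ * N * a * b'

7ℚ 16ℚ : ℚ
7ℚ = (+ 7) / 1
16ℚ = (+ 16) / 1

{-# OPTIONS --safe #-}

-- Write x = s X and y = s Y. Summing the blue degrees over X and the red degrees over Y
-- counts every edge of B(X,Ȳ), R(X̄,Y) and F(X,Y) once, so regularity gives
--   (b - δ)x + (r - δ)y ≤ ε_B(X,Ȳ) + ε_R(X̄,Y) + ε_F(X,Y),
-- while jumbledness together with √(xy) ≤ max(x,y) gives ε_F(X,Y) ≤ (b + r)xy + δ max(x,y).
-- Hence bx + ry - (b + r)xy - δ(x + y + max(x,y)) ≤ ν.  Say ry ≥ bx.  If (b + r)y ≤ b, the
-- term (b + r)xy is absorbed by bx and ry(1 - 3δ/α) ≤ ν.  Otherwise the hypothesis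
-- (b + r)x ≤ r makes (r - (b + r)x)((b + r)y - b) ≥ 0, i.e. bx + ry - (b + r)xy ≥ rb/(b + r),
-- which is at least α/2 and contradicts ν < α/16.
-- The case X ⊆ V₂ is the case X ⊆ V₁ for the transposed graph.

module Submission where

open import Defs
open import Data.Nat using (ℕ; NonZero)
open import Data.Rational using (ℚ; _+_; _-_; _*_; _≤_; _<_; _⊓_; _⊔_; 0ℚ; 1ℚ)
open import Data.Product using (_×_)

open import Algebra.Bundles using (CommutativeMonoid)
import Algebra.Properties.CommutativeMonoid.Sum as MonoidSum
import Algebra.Properties.CommutativeSemigroup as CommSemigroupProperties
open import Data.Bool using (Bool; true; false; if_then_else_; _∧_; not)
import Data.Bool.Properties as Bool
open import Data.Empty using (⊥-elim)
open import Data.Fin using (Fin; zero; suc)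
open import Data.Integer as ℤ using (+_)
import Data.Integer.Properties as ℤ
import Data.Nat as ℕ
import Data.Nat.Properties as ℕ
open import Data.Product using (_,_; proj₁; proj₂)
open import Data.Rational using (_/_; -_; nonNegative; positive; fromℚᵘ)
import Data.Rational.Properties as ℚ
open import Data.Rational.Solver using (module +-*-Solver)
open import Data.Rational.Unnormalised as ℚᵘ using (mkℚᵘ; *≡*)
import Data.Rational.Unnormalised.Properties as ℚᵘ
open import Data.Sum using (_⊎_; inj₁; inj₂)
open import Function using (_∘_)
open import Relation.Binary.PropositionalEquality
open import Relation.Nullary using (yes; no)

open +-*-Solver using (solve; _:+_; _:-_; _:*_; _:=_; con)

*-nonNeg : ∀ {p q} → 0ℚ ≤ p → 0ℚ ≤ q → 0ℚ ≤ p * q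
*-nonNeg {p} {q} 0≤p 0≤q =
  ℚ.nonNegative⁻¹ (p * q) {{ℚ.nonNeg*nonNeg⇒nonNeg p {{nonNegative 0≤p}} q {{nonNegative 0≤q}}}}

+-nonNeg : ∀ {p q} → 0ℚ ≤ p → 0ℚ ≤ q → 0ℚ ≤ p + q
+-nonNeg = ℚ.+-mono-≤

p≤q⇒0≤q-p : ∀ {p q} → p ≤ q → 0ℚ ≤ q - p
p≤q⇒0≤q-p {p} {q} p≤q = subst (_≤ q - p) (ℚ.+-inverseʳ p) (ℚ.+-monoˡ-≤ (- p) p≤q)

≤-by-nonNeg-difference : ∀ {p q} c → q - p ≡ c → 0ℚ ≤ c → p ≤ q
≤-by-nonNeg-difference {p} {q} c q-p≡c 0≤c =
  subst₂ _≤_ (ℚ.+-identityˡ p) q-p+p≡q (ℚ.+-monoˡ-≤ p (subst (0ℚ ≤_) (sym q-p≡c) 0≤c))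
  where
  q-p+p≡q : q - p + p ≡ q
  q-p+p≡q = solve 2 (λ p q → q :- p :+ p := q) refl p q

*-cancelʳ-≤ : ∀ {p q c} → 0ℚ < c → p * c ≤ q * c → p ≤ q
*-cancelʳ-≤ {c = c} 0<c = ℚ.*-cancelʳ-≤-pos c {{positive 0<c}}

*-mono-≤-nonNeg : ∀ {p q u v} → 0ℚ ≤ p → 0ℚ ≤ v → p ≤ q → u ≤ v → p * u ≤ q * v
*-mono-≤-nonNeg {p} {q} {u} {v} 0≤p 0≤v p≤q u≤v = ℚ.≤-trans
  (ℚ.*-monoˡ-≤-nonNeg p {{nonNegative 0≤p}} u≤v) (ℚ.*-monoʳ-≤-nonNeg v {{nonNegative 0≤v}} p≤q)

p*q≤[p⊔q]*[p⊔q] : ∀ {p q} → 0ℚ ≤ p → 0ℚ ≤ q → p * q ≤ (p ⊔ q) * (p ⊔ q)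
p*q≤[p⊔q]*[p⊔q] {p} {q} 0≤p 0≤q =
  *-mono-≤-nonNeg 0≤p (ℚ.≤-trans 0≤q (ℚ.p≤q⊔p p q)) (ℚ.p≤p⊔q p q) (ℚ.p≤q⊔p p q)

p*p≤q*q⇒p≤q : ∀ {p q} → 0ℚ ≤ q → p * p ≤ q * q → p ≤ q
p*p≤q*q⇒p≤q {p} {q} 0≤q p²≤q² with p ℚ.≤? q
... | yes p≤q = p≤q
... | no p≰q = ⊥-elim (ℚ.<-irrefl refl (ℚ.≤-<-trans p²≤q² (ℚ.≤-<-trans q²≤qp qp<p²)))
  where
  q<p = ℚ.≰⇒> p≰q
  q²≤qp : q * q ≤ q * p
  q²≤qp = ℚ.*-monoˡ-≤-nonNeg q {{nonNegative 0≤q}} (ℚ.<⇒≤ q<p)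
  qp<p² : q * p < p * p
  qp<p² = ℚ.*-monoˡ-<-pos p {{positive (ℚ.≤-<-trans 0≤q q<p)}} q<p

ι : ℕ → ℚ
ι k = + k / 1

fromℚᵘ-+ : ∀ p q → fromℚᵘ (p ℚᵘ.+ q) ≡ fromℚᵘ p + fromℚᵘ q
fromℚᵘ-+ p q = ℚ.toℚᵘ-injective (ℚᵘ.≃-trans (ℚ.toℚᵘ-fromℚᵘ (p ℚᵘ.+ q))
  (ℚᵘ.≃-trans (ℚᵘ.+-cong (ℚᵘ.≃-sym (ℚ.toℚᵘ-fromℚᵘ p)) (ℚᵘ.≃-sym (ℚ.toℚᵘ-fromℚᵘ q)))
    (ℚᵘ.≃-sym (ℚ.toℚᵘ-homo-+ (fromℚᵘ p) (fromℚᵘ q)))))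

fromℚᵘ-* : ∀ p q → fromℚᵘ (p ℚᵘ.* q) ≡ fromℚᵘ p * fromℚᵘ q
fromℚᵘ-* p q = ℚ.toℚᵘ-injective (ℚᵘ.≃-trans (ℚ.toℚᵘ-fromℚᵘ (p ℚᵘ.* q))
  (ℚᵘ.≃-trans (ℚᵘ.*-cong (ℚᵘ.≃-sym (ℚ.toℚᵘ-fromℚᵘ p)) (ℚᵘ.≃-sym (ℚ.toℚᵘ-fromℚᵘ q)))
    (ℚᵘ.≃-sym (ℚ.toℚᵘ-homo-* (fromℚᵘ p) (fromℚᵘ q)))))

ι-+ : ∀ m n → ι (m ℕ.+ n) ≡ ι m + ι n
ι-+ m n = trans
  (ℚ.fromℚᵘ-cong {mkℚᵘ (+ (m ℕ.+ n)) 0} {mkℚᵘ (+ m) 0 ℚᵘ.+ mkℚᵘ (+ n) 0} (*≡* numerators))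
  (fromℚᵘ-+ (mkℚᵘ (+ m) 0) (mkℚᵘ (+ n) 0))
  where
  numerators : + (m ℕ.+ n) ℤ.* + 1 ≡ (+ m ℤ.* + 1 ℤ.+ + n ℤ.* + 1) ℤ.* + 1
  numerators = cong (ℤ._* + 1) (trans (ℤ.pos-+ m n)
    (sym (cong₂ ℤ._+_ (ℤ.*-identityʳ (+ m)) (ℤ.*-identityʳ (+ n)))))

ι-* : ∀ m n → ι (m ℕ.* n) ≡ ι m * ι n
ι-* m n = trans
  (ℚ.fromℚᵘ-cong {mkℚᵘ (+ (m ℕ.* n)) 0} {mkℚᵘ (+ m) 0 ℚᵘ.* mkℚᵘ (+ n) 0}
    (*≡* (cong (ℤ._* + 1) (ℤ.pos-* m n))))
  (fromℚᵘ-* (mkℚᵘ (+ m) 0) (mkℚᵘ (+ n) 0))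

/-*-ι : ∀ k n .{{_ : NonZero n}} → + k / n * ι n ≡ ι k
/-*-ι k (ℕ.suc n) = trans (sym (fromℚᵘ-* (mkℚᵘ (+ k) n) (mkℚᵘ (+ ℕ.suc n) 0)))
  (ℚ.fromℚᵘ-cong {mkℚᵘ (+ k) n ℚᵘ.* mkℚᵘ (+ ℕ.suc n) 0} {mkℚᵘ (+ k) 0}
    (*≡* (trans (ℤ.*-identityʳ _) (cong (λ m → + k ℤ.* + ℕ.suc m) (sym (ℕ.*-identityʳ n))))))

ι-nonNeg : ∀ k → 0ℚ ≤ ι k
ι-nonNeg k = ℚ.nonNegative⁻¹ (ι k) {{ℚ.normalize-nonNeg k 1}}

ι-pos : ∀ n .{{_ : NonZero n}} → 0ℚ < ι n
ι-pos (ℕ.suc n) = ℚ.positive⁻¹ (ι (ℕ.suc n)) {{ℚ.normalize-pos (ℕ.suc n) 1}}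

ι-mono-≤ : ∀ {m n} → m ℕ.≤ n → ι m ≤ ι n
ι-mono-≤ {m} {n} m≤n = begin
  ι m                  ≡⟨ ℚ.+-identityʳ (ι m) ⟨
  ι m + 0ℚ             ≤⟨ ℚ.+-monoʳ-≤ (ι m) (ι-nonNeg (n ℕ.∸ m)) ⟩
  ι m + ι (n ℕ.∸ m)    ≡⟨ ι-+ m (n ℕ.∸ m) ⟨
  ι (m ℕ.+ (n ℕ.∸ m))  ≡⟨ cong ι (ℕ.m+[n∸m]≡n m≤n) ⟩
  ι n                  ∎
  where open ℚ.≤-Reasoning

[b+r]y≤b⇒larger-side-bound : ∀ {b r δ ν α x y m} → 0ℚ ≤ α → 0ℚ ≤ δ → 0ℚ ≤ x → 0ℚ ≤ y →
  α * x ≤ r * y → α * y ≤ r * y → α * m ≤ r * y → (b + r) * y ≤ b →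
  b * x + r * y - (b + r) * x * y - δ * (x + y + m) ≤ ν →
  (r * y) * (α - 7ℚ * δ) ≤ ν * α
[b+r]y≤b⇒larger-side-bound {b} {r} {δ} {ν} {α} {x} {y} {m}
    0≤α 0≤δ 0≤x 0≤y αx≤ry αy≤ry αm≤ry [b+r]y≤b deficit≤ν =
  ≤-by-nonNeg-difference _ certificate
    (+-nonNeg (+-nonNeg (+-nonNeg (+-nonNeg (+-nonNeg
      (*-nonNeg 0≤α (p≤q⇒0≤q-p deficit≤ν))
      (*-nonNeg (*-nonNeg 0≤α 0≤x) (p≤q⇒0≤q-p [b+r]y≤b)))
      (*-nonNeg 0≤δ (p≤q⇒0≤q-p αx≤ry)))
      (*-nonNeg 0≤δ (p≤q⇒0≤q-p αy≤ry)))
      (*-nonNeg 0≤δ (p≤q⇒0≤q-p αm≤ry)))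
      (*-nonNeg (*-nonNeg (ι-nonNeg 4) 0≤δ) (ℚ.≤-trans (*-nonNeg 0≤α 0≤y) αy≤ry)))
  where
  certificate : ν * α - (r * y) * (α - 7ℚ * δ)
    ≡ α * (ν - (b * x + r * y - (b + r) * x * y - δ * (x + y + m)))
      + α * x * (b - (b + r) * y)
      + δ * (r * y - α * x) + δ * (r * y - α * y) + δ * (r * y - α * m)
      + ι 4 * δ * (r * y)
  certificate = solve 8 (λ b r x y m δ ν α →
    ν :* α :- (r :* y) :* (α :- con 7ℚ :* δ)
    := α :* (ν :- (b :* x :+ r :* y :- (b :+ r) :* x :* y :- δ :* (x :+ y :+ m)))
       :+ α :* x :* (b :- (b :+ r) :* y)
       :+ δ :* (r :* y :- α :* x) :+ δ :* (r :* y :- α :* y) :+ δ :* (r :* y :- α :* m)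
       :+ con (ι 4) :* δ :* (r :* y)) refl b r x y m δ ν α

b≤[b+r]y⇒α≤16ν : ∀ {b r δ ν α x y m} → 0ℚ < b → 0ℚ < r → 0ℚ ≤ δ →
  16ℚ * δ ≤ α → α ≤ b → α ≤ r → x ≤ 1ℚ → y ≤ 1ℚ → m ≤ 1ℚ →
  (b * x) * (r + b) ≤ r * b → b ≤ (b + r) * y →
  b * x + r * y - (b + r) * x * y - δ * (x + y + m) ≤ ν →
  α ≤ 16ℚ * ν
b≤[b+r]y⇒α≤16ν {b} {r} {δ} {ν} {α} {x} {y} {m}
    0<b 0<r 0≤δ 16δ≤α α≤b α≤r x≤1 y≤1 m≤1 bx[r+b]≤rb b≤[b+r]y deficit≤ν =
  *-cancelʳ-≤ (ℚ.+-mono-< 0<b 0<r) (≤-by-nonNeg-difference _ certificate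
    (+-nonNeg (+-nonNeg (+-nonNeg (+-nonNeg (+-nonNeg (+-nonNeg
      (*-nonNeg (*-nonNeg 0≤16 0≤b+r) (p≤q⇒0≤q-p deficit≤ν))
      (*-nonNeg 0≤16 (*-nonNeg (p≤q⇒0≤q-p [b+r]x≤r) (p≤q⇒0≤q-p b≤[b+r]y))))
      (*-nonNeg (*-nonNeg (*-nonNeg 0≤16 0≤b+r) 0≤δ)
        (+-nonNeg (+-nonNeg (p≤q⇒0≤q-p x≤1) (p≤q⇒0≤q-p y≤1)) (p≤q⇒0≤q-p m≤1))))
      (*-nonNeg (*-nonNeg (ι-nonNeg 3) 0≤b+r) (p≤q⇒0≤q-p 16δ≤α)))
      (*-nonNeg (*-nonNeg (ι-nonNeg 4) 0≤b) (p≤q⇒0≤q-p α≤r)))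
      (*-nonNeg (*-nonNeg (ι-nonNeg 4) 0≤r) (p≤q⇒0≤q-p α≤b)))
      (*-nonNeg (*-nonNeg (ι-nonNeg 8) 0≤r) 0≤b)))
  where
  0≤b = ℚ.<⇒≤ 0<b
  0≤r = ℚ.<⇒≤ 0<r
  0≤b+r = +-nonNeg 0≤b 0≤r
  0≤16 = ι-nonNeg 16
  [b+r]x≤r : (b + r) * x ≤ r
  [b+r]x≤r = *-cancelʳ-≤ 0<b (subst (_≤ r * b)
    (solve 3 (λ b r x → (b :* x) :* (r :+ b) := (b :+ r) :* x :* b) refl b r x) bx[r+b]≤rb)
  certificate : 16ℚ * ν * (b + r) - α * (b + r)
    ≡ 16ℚ * (b + r) * (ν - (b * x + r * y - (b + r) * x * y - δ * (x + y + m)))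
      + 16ℚ * ((r - (b + r) * x) * ((b + r) * y - b))
      + 16ℚ * (b + r) * δ * ((1ℚ - x) + (1ℚ - y) + (1ℚ - m))
      + ι 3 * (b + r) * (α - 16ℚ * δ) + ι 4 * b * (r - α) + ι 4 * r * (b - α) + ι 8 * r * b
  certificate = solve 8 (λ b r x y m δ ν α →
    con 16ℚ :* ν :* (b :+ r) :- α :* (b :+ r)
    := con 16ℚ :* (b :+ r) :* (ν :- (b :* x :+ r :* y :- (b :+ r) :* x :* y :- δ :* (x :+ y :+ m)))
       :+ con 16ℚ :* ((r :- (b :+ r) :* x) :* ((b :+ r) :* y :- b))
       :+ con 16ℚ :* (b :+ r) :* δ :* ((con 1ℚ :- x) :+ (con 1ℚ :- y) :+ (con 1ℚ :- m))
       :+ con (ι 3) :* (b :+ r) :* (α :- con 16ℚ :* δ) :+ con (ι 4) :* b :* (r :- α)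
       :+ con (ι 4) :* r :* (b :- α) :+ con (ι 8) :* r :* b) refl b r x y m δ ν α

larger-side-bound : ∀ {b r δ ν α x y m} → 0ℚ < b → 0ℚ < r → 0ℚ ≤ δ →
  16ℚ * ν < α → 16ℚ * δ ≤ α → α ≤ b → α ≤ r →
  0ℚ ≤ x → x ≤ 1ℚ → 0ℚ ≤ y → y ≤ 1ℚ → m ≤ 1ℚ → α * m ≤ r * y → b * x ≤ r * y →
  (b * x) * (r + b) ≤ r * b →
  b * x + r * y - (b + r) * x * y - δ * (x + y + m) ≤ ν →
  (r * y) * (α - 7ℚ * δ) ≤ ν * α
larger-side-bound {b} {r} {δ} {ν} {α} {x} {y}
    0<b 0<r 0≤δ 16ν<α 16δ≤α α≤b α≤r 0≤x x≤1 0≤y y≤1 m≤1 αm≤ry bx≤ry bx[r+b]≤rb deficit≤ν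
  with ℚ.≤-total ((b + r) * y) b
... | inj₁ [b+r]y≤b =
  [b+r]y≤b⇒larger-side-bound 0≤α 0≤δ 0≤x 0≤y αx≤ry αy≤ry αm≤ry [b+r]y≤b deficit≤ν
  where
  0≤α = ℚ.≤-trans (*-nonNeg (ι-nonNeg 16) 0≤δ) 16δ≤α
  αx≤ry = ℚ.≤-trans (ℚ.*-monoʳ-≤-nonNeg x {{nonNegative 0≤x}} α≤b) bx≤ry
  αy≤ry = ℚ.*-monoʳ-≤-nonNeg y {{nonNegative 0≤y}} α≤r
... | inj₂ b≤[b+r]y = ⊥-elim (ℚ.<-irrefl refl (ℚ.<-≤-trans 16ν<α
  (b≤[b+r]y⇒α≤16ν 0<b 0<r 0≤δ 16δ≤α α≤b α≤r x≤1 y≤1 m≤1 bx[r+b]≤rb b≤[b+r]y deficit≤ν)))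

max-bound : ∀ (r b ν δ : ℚ) {x y E G} →
  0ℚ < r → 0ℚ < b → 16ℚ * ν < r ⊓ b → 0ℚ ≤ δ → 16ℚ * δ ≤ r ⊓ b →
  0ℚ ≤ x → x ≤ 1ℚ → 0ℚ ≤ y → y ≤ 1ℚ →
  (b - δ) * x + (r - δ) * y ≤ E + G → G ≤ (b + r) * x * y + δ * (x ⊔ y) → E ≤ ν →
  ((b * x) ⊓ (r * y)) * (r + b) ≤ r * b →
  ((b * x) ⊔ (r * y)) * ((r ⊓ b) - 7ℚ * δ) ≤ ν * (r ⊓ b)
max-bound r b ν δ {x} {y} {E} {G} 0<r 0<b 16ν<α 0≤δ 16δ≤α 0≤x x≤1 0≤y y≤1 degrees G≤ E≤ν balanced =
  by-cases (ℚ.≤-total (b * x) (r * y))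
  where
  α = r ⊓ b
  α≤r = ℚ.p⊓q≤p r b
  α≤b = ℚ.p⊓q≤q r b
  0≤α = ℚ.≤-trans (*-nonNeg (ι-nonNeg 16) 0≤δ) 16δ≤α
  x⊔y≤1 = ℚ.⊔-lub x≤1 y≤1

  α[x⊔y]≤max : α * (x ⊔ y) ≤ (b * x) ⊔ (r * y)
  α[x⊔y]≤max = subst (_≤ (b * x) ⊔ (r * y)) (sym (ℚ.*-distribˡ-⊔-nonNeg α {{nonNegative 0≤α}} x y))
    (ℚ.⊔-mono-≤ (ℚ.*-monoʳ-≤-nonNeg x {{nonNegative 0≤x}} α≤b)
                 (ℚ.*-monoʳ-≤-nonNeg y {{nonNegative 0≤y}} α≤r))

  deficit≤ν : b * x + r * y - (b + r) * x * y - δ * (x + y + (x ⊔ y)) ≤ ν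
  deficit≤ν = ≤-by-nonNeg-difference _
    (solve 9 (λ b r δ ν x y m E G →
       ν :- (b :* x :+ r :* y :- (b :+ r) :* x :* y :- δ :* (x :+ y :+ m))
       := (ν :- E) :+ (E :+ G :- ((b :- δ) :* x :+ (r :- δ) :* y)) :+ ((b :+ r) :* x :* y :+ δ :* m :- G))
       refl b r δ ν x y (x ⊔ y) E G)
    (+-nonNeg (+-nonNeg (p≤q⇒0≤q-p E≤ν) (p≤q⇒0≤q-p degrees)) (p≤q⇒0≤q-p G≤))

  by-cases : (b * x ≤ r * y) ⊎ (r * y ≤ b * x) → ((b * x) ⊔ (r * y)) * (α - 7ℚ * δ) ≤ ν * α
  by-cases (inj₁ bx≤ry) = subst (λ M → M * (α - 7ℚ * δ) ≤ ν * α) (sym (ℚ.p≤q⇒p⊔q≡q bx≤ry))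
    (larger-side-bound 0<b 0<r 0≤δ 16ν<α 16δ≤α α≤b α≤r 0≤x x≤1 0≤y y≤1 x⊔y≤1
      (subst (α * (x ⊔ y) ≤_) (ℚ.p≤q⇒p⊔q≡q bx≤ry) α[x⊔y]≤max) bx≤ry
      (subst (λ M → M * (r + b) ≤ r * b) (ℚ.p≤q⇒p⊓q≡p bx≤ry) balanced) deficit≤ν)
  by-cases (inj₂ ry≤bx) = subst (λ M → M * (α - 7ℚ * δ) ≤ ν * α) (sym (ℚ.p≥q⇒p⊔q≡p ry≤bx))
    (larger-side-bound 0<r 0<b 0≤δ 16ν<α 16δ≤α α≤r α≤b 0≤y y≤1 0≤x x≤1 x⊔y≤1
      (subst (α * (x ⊔ y) ≤_) (ℚ.p≥q⇒p⊔q≡p ry≤bx) α[x⊔y]≤max) ry≤bx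
      (subst₂ (λ c d → r * y * c ≤ d) (ℚ.+-comm r b) (ℚ.*-comm r b)
        (subst (λ M → M * (r + b) ≤ r * b) (ℚ.p≥q⇒p⊓q≡q ry≤bx) balanced))
      (subst (_≤ ν) (solve 6 (λ b r δ x y m →
          b :* x :+ r :* y :- (b :+ r) :* x :* y :- δ :* (x :+ y :+ m)
          := r :* y :+ b :* x :- (r :+ b) :* y :* x :- δ :* (y :+ x :+ m)) refl b r δ x y (x ⊔ y)) deficit≤ν))

-- a, c, G and M stand for |X|, |Y|, e_F(X,Y) and n₁n₂ as they occur in Jumbled.
jumbled⇒normalised-bound : ∀ {π δ x y g n₁ n₂ a c G M} →
  0ℚ ≤ δ → 0ℚ < n₁ → 0ℚ < n₂ → 0ℚ ≤ x → 0ℚ ≤ y →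
  x * n₁ ≡ a → y * n₂ ≡ c → g * (n₁ * n₂) ≡ G → n₁ * n₂ ≡ M →
  (G - π * a * c) * (G - π * a * c) ≤ δ * δ * M * a * c →
  g ≤ π * x * y + δ * (x ⊔ y)
jumbled⇒normalised-bound {π} {δ} {x} {y} {g} {n₁} {n₂} 0≤δ 0<n₁ 0<n₂ 0≤x 0≤y refl refl refl refl jumbled =
  ≤-by-nonNeg-difference _
    (solve 6 (λ π δ x y m g → π :* x :* y :+ δ :* m :- g := δ :* m :- (g :- π :* x :* y)) refl π δ x y (x ⊔ y) g)
    (p≤q⇒0≤q-p deviation≤)
  where
  open ℚ.≤-Reasoning
  N = n₁ * n₂
  0<N² = ℚ.positive⁻¹ (N * N) {{ℚ.pos*pos⇒pos N {{pN}} N {{pN}}}}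
    where pN = ℚ.pos*pos⇒pos n₁ {{positive 0<n₁}} n₂ {{positive 0<n₂}}
  deviation≤ : g - π * x * y ≤ δ * (x ⊔ y)
  deviation≤ = p*p≤q*q⇒p≤q (*-nonNeg 0≤δ (ℚ.≤-trans 0≤x (ℚ.p≤p⊔q x y))) (*-cancelʳ-≤ 0<N² (begin
    (g - π * x * y) * (g - π * x * y) * (N * N)
      ≡⟨ solve 6 (λ π x y g n₁ n₂ →
           (g :- π :* x :* y) :* (g :- π :* x :* y) :* (n₁ :* n₂ :* (n₁ :* n₂))
           := (g :* (n₁ :* n₂) :- π :* (x :* n₁) :* (y :* n₂))
              :* (g :* (n₁ :* n₂) :- π :* (x :* n₁) :* (y :* n₂)))
           refl π x y g n₁ n₂ ⟩
    (g * N - π * (x * n₁) * (y * n₂)) * (g * N - π * (x * n₁) * (y * n₂))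
      ≤⟨ jumbled ⟩
    δ * δ * N * (x * n₁) * (y * n₂)
      ≡⟨ solve 5 (λ δ x y n₁ n₂ → δ :* δ :* (n₁ :* n₂) :* (x :* n₁) :* (y :* n₂)
           := δ :* δ :* (x :* y) :* (n₁ :* n₂ :* (n₁ :* n₂))) refl δ x y n₁ n₂ ⟩
    δ * δ * (x * y) * (N * N)
      ≤⟨ ℚ.*-monoʳ-≤-nonNeg (N * N) {{nonNegative (ℚ.<⇒≤ 0<N²)}}
           (ℚ.*-monoˡ-≤-nonNeg (δ * δ) {{nonNegative (*-nonNeg 0≤δ 0≤δ)}} (p*q≤[p⊔q]*[p⊔q] 0≤x 0≤y)) ⟩
    δ * δ * ((x ⊔ y) * (x ⊔ y)) * (N * N)
      ≡⟨ solve 3 (λ δ m K → δ :* δ :* (m :* m) :* K := δ :* m :* (δ :* m) :* K) refl δ (x ⊔ y) (N * N) ⟩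
    δ * (x ⊔ y) * (δ * (x ⊔ y)) * (N * N) ∎))

open MonoidSum ℕ.+-0-commutativeMonoid using (sum; ∑-distrib-+; ∑-comm; sum-cong-≗; sum-replicate-zero)
open CommSemigroupProperties ℕ.+-commutativeSemigroup using (interchange)
open CommSemigroupProperties (CommutativeMonoid.commutativeSemigroup Bool.∧-commutativeMonoid)
  using () renaming (x∙yz≈y∙xz to ∧-swapˡ)

Σ≡sum : ∀ n (f : Fin n → ℕ) → Σ n f ≡ sum f
Σ≡sum ℕ.zero    f = refl
Σ≡sum (ℕ.suc n) f = cong (f zero ℕ.+_) (Σ≡sum n (f ∘ suc))

Σ-cong : ∀ n {f g : Fin n → ℕ} → (∀ i → f i ≡ g i) → Σ n f ≡ Σ n g
Σ-cong n {f} {g} f≗g = trans (Σ≡sum n f) (trans (sum-cong-≗ f≗g) (sym (Σ≡sum n g)))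

Σ-distrib-+ : ∀ n (f g : Fin n → ℕ) → Σ n (λ i → f i ℕ.+ g i) ≡ Σ n f ℕ.+ Σ n g
Σ-distrib-+ n f g = trans (Σ≡sum n _)
  (trans (∑-distrib-+ f g) (sym (cong₂ ℕ._+_ (Σ≡sum n f) (Σ≡sum n g))))

Σ-comm : ∀ m n (f : Fin m → Fin n → ℕ) → Σ m (λ i → Σ n (f i)) ≡ Σ n (λ j → Σ m (λ i → f i j))
Σ-comm m n f = begin
  Σ m (λ i → Σ n (f i))          ≡⟨ Σ-cong m (λ i → Σ≡sum n (f i)) ⟩
  Σ m (λ i → sum (f i))          ≡⟨ Σ≡sum m _ ⟩
  sum (λ i → sum (f i))          ≡⟨ ∑-comm f ⟩
  sum (λ j → sum (λ i → f i j))  ≡⟨ Σ≡sum n _ ⟨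
  Σ n (λ j → sum (λ i → f i j))  ≡⟨ Σ-cong n (λ j → Σ≡sum m (λ i → f i j)) ⟨
  Σ n (λ j → Σ m (λ i → f i j))  ∎
  where open ≡-Reasoning

Σ-zero : ∀ n → Σ n (λ _ → 0) ≡ 0
Σ-zero n = trans (Σ≡sum n _) (sum-replicate-zero n)

Σ-if : ∀ n (a : Bool) (f : Fin n → ℕ) → Σ n (λ i → if a then f i else 0) ≡ (if a then Σ n f else 0)
Σ-if n true  f = refl
Σ-if n false f = Σ-zero n

Σ-on : ∀ {n} → Subset n → (Fin n → ℕ) → ℕ
Σ-on {n} X f = Σ n (λ v → if X v then f v else 0)

size≤n : ∀ {n} (X : Subset n) → size X ℕ.≤ n
size≤n {ℕ.zero}  X = ℕ.z≤n
size≤n {ℕ.suc n} X = step (X zero) (size≤n (X ∘ suc))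
  where
  step : ∀ a {k} → k ℕ.≤ n → (if a then 1 else 0) ℕ.+ k ℕ.≤ ℕ.suc n
  step true  = ℕ.s≤s
  step false = ℕ.m≤n⇒m≤1+n

*-Σ-≤ : ∀ n c (f g : Fin n → ℕ) → (∀ i → c * ι (f i) ≤ ι (g i)) → c * ι (Σ n f) ≤ ι (Σ n g)
*-Σ-≤ ℕ.zero    c f g _ = ℚ.≤-reflexive (ℚ.*-zeroʳ c)
*-Σ-≤ (ℕ.suc n) c f g fg = begin
  c * ι (f zero ℕ.+ Σ n (f ∘ suc))          ≡⟨ cong (c *_) (ι-+ (f zero) _) ⟩
  c * (ι (f zero) + ι (Σ n (f ∘ suc)))      ≡⟨ ℚ.*-distribˡ-+ c _ _ ⟩
  c * ι (f zero) + c * ι (Σ n (f ∘ suc))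
    ≤⟨ ℚ.+-mono-≤ (fg zero) (*-Σ-≤ n c (f ∘ suc) (g ∘ suc) (fg ∘ suc)) ⟩
  ι (g zero) + ι (Σ n (g ∘ suc))            ≡⟨ ι-+ (g zero) _ ⟨
  ι (g zero ℕ.+ Σ n (g ∘ suc))              ∎
  where open ℚ.≤-Reasoning

Σ-on-≥ : ∀ {n} (X : Subset n) (f : Fin n → ℕ) {c} →
  (∀ v → c ≤ ι (f v)) → c * ι (size X) ≤ ι (Σ-on X f)
Σ-on-≥ {n} X f {c} c≤f = *-Σ-≤ n c _ _ (λ v → on (X v) (c≤f v))
  where
  on : ∀ a {k} → c ≤ ι k → c * ι (if a then 1 else 0) ≤ ι (if a then k else 0)
  on true  c≤k = subst (_≤ _) (sym (ℚ.*-identityʳ c)) c≤k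
  on false _   = ℚ.≤-reflexive (ℚ.*-zeroʳ c)

module _ {n : ℕ} .{{_ : NonZero n}} (X : Subset n) where

  s-*-ι : s X * ι n ≡ ι (size X)
  s-*-ι = /-*-ι (size X) n

  0≤s : 0ℚ ≤ s X
  0≤s = ℚ.nonNegative⁻¹ (s X) {{ℚ.normalize-nonNeg (size X) n}}

  s≤1 : s X ≤ 1ℚ
  s≤1 = *-cancelʳ-≤ (ι-pos n)
    (subst₂ _≤_ (sym s-*-ι) (sym (ℚ.*-identityˡ (ι n))) (ι-mono-≤ (size≤n X)))

_ᵀ : ∀ {n₁ n₂} → BlueRed n₁ n₂ → BlueRed n₂ n₁
(F ᵀ) w u = F u w

module _ {n₁ n₂ : ℕ} (F : BlueRed n₁ n₂) where

  e-ᵀ : ∀ H (X : Subset n₁) (Y : Subset n₂) → e (F ᵀ) H Y X ≡ e F H X Y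
  e-ᵀ H X Y = trans (Σ-comm n₂ n₁ _) (Σ-cong n₁ λ u → Σ-cong n₂ λ w →
    cong (λ a → if a then 1 else 0) (∧-swapˡ (Y w) (X u) (sel H (F u w))))

  Σ-on-deg₁ : ∀ H (X : Subset n₁) (Y : Subset n₂) → Σ-on X (deg₁ F H) ≡ e F H X (∁ Y) ℕ.+ e F H X Y
  Σ-on-deg₁ H X Y =
    trans (Σ-cong n₁ (λ u → sym (Σ-if n₂ (X u) _)))
    (trans (Σ-cong n₁ (λ u → Σ-cong n₂ (λ w → split (X u) (Y w) (sel H (F u w)))))
    (trans (Σ-cong n₁ (λ u → Σ-distrib-+ n₂ _ _))
      (Σ-distrib-+ n₁ _ _)))
    where
    split : ∀ a y c → (if a then (if c then 1 else 0) else 0)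
      ≡ (if a ∧ (not y ∧ c) then 1 else 0) ℕ.+ (if a ∧ (y ∧ c) then 1 else 0)
    split false y     c     = refl
    split true  true  c     = refl
    split true  false true  = refl
    split true  false false = refl

  e-𝐁+e-𝐑 : ∀ (X : Subset n₁) (Y : Subset n₂) → e F 𝐁 X Y ℕ.+ e F 𝐑 X Y ≡ e F 𝐅 X Y
  e-𝐁+e-𝐑 X Y = trans (sym (Σ-distrib-+ n₁ _ _)) (Σ-cong n₁ λ u →
    trans (sym (Σ-distrib-+ n₂ _ _)) (Σ-cong n₂ λ w → split (X u) (Y w) (F u w)))
    where
    split : ∀ a y c → (if a ∧ (y ∧ isBlue c) then 1 else 0) ℕ.+ (if a ∧ (y ∧ isRed c) then 1 else 0)
      ≡ (if a ∧ (y ∧ isEdge c) then 1 else 0)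
    split false y     c    = refl
    split true  false c    = refl
    split true  true  none = refl
    split true  true  blue = refl
    split true  true  red  = refl

Σ-on-deg₂ : ∀ {n₁ n₂} (F : BlueRed n₁ n₂) H (X : Subset n₁) (Y : Subset n₂) →
  Σ-on Y (deg₂ F H) ≡ e F H (∁ X) Y ℕ.+ e F H X Y
Σ-on-deg₂ F H X Y = trans (Σ-on-deg₁ (F ᵀ) H Y X) (cong₂ ℕ._+_ (e-ᵀ F H (∁ X) Y) (e-ᵀ F H X Y))

degree-count : ∀ {n₁ n₂} (F : BlueRed n₁ n₂) (X : Subset n₁) (Y : Subset n₂) →
  Σ-on X (deg₁ F 𝐁) ℕ.+ Σ-on Y (deg₂ F 𝐑) ≡ e F 𝐁 X (∁ Y) ℕ.+ e F 𝐑 (∁ X) Y ℕ.+ e F 𝐅 X Y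
degree-count F X Y = begin
  Σ-on X (deg₁ F 𝐁) ℕ.+ Σ-on Y (deg₂ F 𝐑)
    ≡⟨ cong₂ ℕ._+_ (Σ-on-deg₁ F 𝐁 X Y) (Σ-on-deg₂ F 𝐑 X Y) ⟩
  (e F 𝐁 X (∁ Y) ℕ.+ e F 𝐁 X Y) ℕ.+ (e F 𝐑 (∁ X) Y ℕ.+ e F 𝐑 X Y)
    ≡⟨ interchange (e F 𝐁 X (∁ Y)) _ _ _ ⟩
  (e F 𝐁 X (∁ Y) ℕ.+ e F 𝐑 (∁ X) Y) ℕ.+ (e F 𝐁 X Y ℕ.+ e F 𝐑 X Y)
    ≡⟨ cong (e F 𝐁 X (∁ Y) ℕ.+ e F 𝐑 (∁ X) Y ℕ.+_) (e-𝐁+e-𝐑 F X Y) ⟩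
  e F 𝐁 X (∁ Y) ℕ.+ e F 𝐑 (∁ X) Y ℕ.+ e F 𝐅 X Y ∎
  where open ≡-Reasoning

module _ {n₁ n₂ : ℕ} .{{_ : NonZero n₁}} .{{_ : NonZero n₂}} where

  ε-ᵀ : ∀ (F : BlueRed n₁ n₂) H (X : Subset n₁) (Y : Subset n₂) → ε (F ᵀ) H Y X ≡ ε F H X Y
  ε-ᵀ F H X Y =
    ℚ./-cong {{ℕ.m*n≢0 n₂ n₁}} {{ℕ.m*n≢0 n₁ n₂}} (cong +_ (e-ᵀ F H X Y)) (ℕ.*-comm n₂ n₁)

  ε-*-ι : ∀ (F : BlueRed n₁ n₂) H (X : Subset n₁) (Y : Subset n₂) →
    ε F H X Y * (ι n₁ * ι n₂) ≡ ι (e F H X Y)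
  ε-*-ι F H X Y = trans (cong (ε F H X Y *_) (sym (ι-* n₁ n₂)))
    (/-*-ι (e F H X Y) (n₁ ℕ.* n₂) {{ℕ.m*n≢0 n₁ n₂}})

  regular-ᵀ : ∀ {F : BlueRed n₁ n₂} {r b δ} → Regular F r b δ → Regular (F ᵀ) r b δ
  regular-ᵀ (onV₁ , onV₂) = onV₂ , onV₁

  degree-bound : ∀ {r b δ : ℚ} (F : BlueRed n₁ n₂) → Regular F r b δ → (X : Subset n₁) (Y : Subset n₂) →
    (b - δ) * s X + (r - δ) * s Y ≤ ε F 𝐁 X (∁ Y) + ε F 𝐑 (∁ X) Y + ε F 𝐅 X Y
  degree-bound {r} {b} {δ} F (onV₁ , onV₂) X Y = *-cancelʳ-≤ 0<N (begin
    ((b - δ) * s X + (r - δ) * s Y) * N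
      ≡⟨ solve 7 (λ b r δ x y n₁ n₂ → ((b :- δ) :* x :+ (r :- δ) :* y) :* (n₁ :* n₂)
           := (b :- δ) :* n₂ :* (x :* n₁) :+ (r :- δ) :* n₁ :* (y :* n₂))
           refl b r δ (s X) (s Y) (ι n₁) (ι n₂) ⟩
    (b - δ) * ι n₂ * (s X * ι n₁) + (r - δ) * ι n₁ * (s Y * ι n₂)
      ≡⟨ cong₂ (λ a c → (b - δ) * ι n₂ * a + (r - δ) * ι n₁ * c) (s-*-ι X) (s-*-ι Y) ⟩
    (b - δ) * ι n₂ * ι (size X) + (r - δ) * ι n₁ * ι (size Y)
      ≤⟨ ℚ.+-mono-≤ (Σ-on-≥ X (deg₁ F 𝐁) blue-degree) (Σ-on-≥ Y (deg₂ F 𝐑) red-degree) ⟩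
    ι (Σ-on X (deg₁ F 𝐁)) + ι (Σ-on Y (deg₂ F 𝐑))
      ≡⟨ ι-+ (Σ-on X (deg₁ F 𝐁)) (Σ-on Y (deg₂ F 𝐑)) ⟨
    ι (Σ-on X (deg₁ F 𝐁) ℕ.+ Σ-on Y (deg₂ F 𝐑))
      ≡⟨ cong ι (degree-count F X Y) ⟩
    ι (e F 𝐁 X (∁ Y) ℕ.+ e F 𝐑 (∁ X) Y ℕ.+ e F 𝐅 X Y)
      ≡⟨ ι-+ (e F 𝐁 X (∁ Y) ℕ.+ e F 𝐑 (∁ X) Y) (e F 𝐅 X Y) ⟩
    ι (e F 𝐁 X (∁ Y) ℕ.+ e F 𝐑 (∁ X) Y) + ι (e F 𝐅 X Y)
      ≡⟨ cong (_+ ι (e F 𝐅 X Y)) (ι-+ (e F 𝐁 X (∁ Y)) (e F 𝐑 (∁ X) Y)) ⟩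
    ι (e F 𝐁 X (∁ Y)) + ι (e F 𝐑 (∁ X) Y) + ι (e F 𝐅 X Y)
      ≡⟨ cong₂ _+_ (cong₂ _+_ (ε-*-ι F 𝐁 X (∁ Y)) (ε-*-ι F 𝐑 (∁ X) Y)) (ε-*-ι F 𝐅 X Y) ⟨
    ε F 𝐁 X (∁ Y) * N + ε F 𝐑 (∁ X) Y * N + ε F 𝐅 X Y * N
      ≡⟨ solve 4 (λ a c g N → a :* N :+ c :* N :+ g :* N := (a :+ c :+ g) :* N)
           refl (ε F 𝐁 X (∁ Y)) (ε F 𝐑 (∁ X) Y) (ε F 𝐅 X Y) N ⟩
    (ε F 𝐁 X (∁ Y) + ε F 𝐑 (∁ X) Y + ε F 𝐅 X Y) * N ∎)
    where
    open ℚ.≤-Reasoning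
    N = ι n₁ * ι n₂
    0<N = subst (0ℚ <_) (ι-* n₁ n₂) (ι-pos (n₁ ℕ.* n₂) {{ℕ.m*n≢0 n₁ n₂}})
    blue-degree : ∀ u → (b - δ) * ι n₂ ≤ ι (deg₁ F 𝐁 u)
    blue-degree u = subst ((b - δ) * ι n₂ ≤_) (/-*-ι (deg₁ F 𝐁 u) n₂)
      (ℚ.*-monoʳ-≤-nonNeg (ι n₂) {{nonNegative (ι-nonNeg n₂)}} (proj₁ (proj₁ (onV₁ u))))
    red-degree : ∀ w → (r - δ) * ι n₁ ≤ ι (deg₂ F 𝐑 w)
    red-degree w = subst ((r - δ) * ι n₁ ≤_) (/-*-ι (deg₂ F 𝐑 w) n₁)
      (ℚ.*-monoʳ-≤-nonNeg (ι n₁) {{nonNegative (ι-nonNeg n₁)}} (proj₁ (proj₂ (onV₂ w))))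

  jumbled-bound : ∀ {π δ} (F : BlueRed n₁ n₂) → Jumbled F π δ → 0ℚ ≤ δ →
    (X : Subset n₁) (Y : Subset n₂) →
    ε F 𝐅 X Y ≤ π * s X * s Y + δ * (s X ⊔ s Y)
  jumbled-bound {π} F J 0≤δ X Y = jumbled⇒normalised-bound {π} 0≤δ (ι-pos n₁) (ι-pos n₂) (0≤s X) (0≤s Y)
    (s-*-ι X) (s-*-ι Y) (ε-*-ι F 𝐅 X Y) (sym (ι-* n₁ n₂)) (J X Y)

  bound-for-X⊆V₁ : ∀ (r b ν δ : ℚ) →
    0ℚ < r → 0ℚ < b → 16ℚ * ν < r ⊓ b → 0ℚ ≤ δ → 16ℚ * δ ≤ r ⊓ b →
    (F : BlueRed n₁ n₂) → Regular F r b δ → Jumbled F (b + r) δ →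
    (X : Subset n₁) (Y : Subset n₂) →
    ε F 𝐁 X (∁ Y) + ε F 𝐑 (∁ X) Y ≤ ν →
    ((b * s X) ⊓ (r * s Y)) * (r + b) ≤ r * b →
    ((b * s X) ⊔ (r * s Y)) * ((r ⊓ b) - 7ℚ * δ) ≤ ν * (r ⊓ b)
  bound-for-X⊆V₁ r b ν δ 0<r 0<b 16ν<α 0≤δ 16δ≤α F regular jumbled X Y =
    max-bound r b ν δ 0<r 0<b 16ν<α 0≤δ 16δ≤α (0≤s X) (s≤1 X) (0≤s Y) (s≤1 Y)
      (degree-bound {r} {b} {δ} F regular X Y) (jumbled-bound {b + r} F jumbled 0≤δ X Y)

jumbled-ᵀ : ∀ {n₁ n₂} {F : BlueRed n₁ n₂} {π δ} → Jumbled F π δ → Jumbled (F ᵀ) π δ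
jumbled-ᵀ {n₁} {n₂} {F} {π} {δ} J A B = subst₂ _≤_ (cong (λ D → D * D) deviation≡) bound≡ (J B A)
  where
  a = ι (size A)
  c = ι (size B)
  deviation≡ : ι (e F 𝐅 B A) - π * c * a ≡ ι (e (F ᵀ) 𝐅 A B) - π * a * c
  deviation≡ = cong₂ _-_ (cong ι (sym (e-ᵀ F 𝐅 B A)))
    (solve 3 (λ π c a → π :* c :* a := π :* a :* c) refl π c a)
  bound≡ : δ * δ * ι (n₁ ℕ.* n₂) * c * a ≡ δ * δ * ι (n₂ ℕ.* n₁) * a * c
  bound≡ = trans (cong (λ k → δ * δ * ι k * c * a) (ℕ.*-comm n₁ n₂))
    (solve 3 (λ p c a → p :* c :* a := p :* a :* c) refl (δ * δ * ι (n₂ ℕ.* n₁)) c a)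

lemma18 : ∀ {n₁ n₂ : ℕ} .{{_ : NonZero n₁}} .{{_ : NonZero n₂}}
    (r b ν δ : ℚ) →
    0ℚ < r → r < 1ℚ → 0ℚ < b → b < 1ℚ →
    0ℚ < ν → 16ℚ * ν < r ⊓ b →
    0ℚ < δ → 16ℚ * δ ≤ r ⊓ b →
    (F : BlueRed n₁ n₂) →
    Regular F r b δ → Jumbled F (b + r) δ →
    -- case i = 1 : X ⊆ V₁, Y ⊆ V₂
    (∀ (X : Subset n₁) (Y : Subset n₂) →
      ε F 𝐁 X (∁ Y) + ε F 𝐑 (∁ X) Y ≤ ν →
      ((b * s X) ⊓ (r * s Y)) * (r + b) ≤ r * b →
      ((b * s X) ⊔ (r * s Y)) * ((r ⊓ b) - 7ℚ * δ) ≤ ν * (r ⊓ b)) ×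
    -- case i = 2 : X ⊆ V₂, Y ⊆ V₁
    (∀ (X : Subset n₂) (Y : Subset n₁) →
      ε F 𝐁 (∁ Y) X + ε F 𝐑 Y (∁ X) ≤ ν →
      ((b * s X) ⊓ (r * s Y)) * (r + b) ≤ r * b →
      ((b * s X) ⊔ (r * s Y)) * ((r ⊓ b) - 7ℚ * δ) ≤ ν * (r ⊓ b))
lemma18 r b ν δ 0<r _ 0<b _ _ 16ν<α 0<δ 16δ≤α F regular jumbled =
  bound-for-X⊆V₁ r b ν δ 0<r 0<b 16ν<α 0≤δ 16δ≤α F regular jumbled ,
  λ X Y boundary≤ν → bound-for-X⊆V₁ r b ν δ 0<r 0<b 16ν<α 0≤δ 16δ≤α
    (F ᵀ) (regular-ᵀ {r = r} {b = b} {δ = δ} regular) (jumbled-ᵀ {π = b + r} {δ = δ} jumbled) X Y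
    (subst (_≤ ν) (sym (cong₂ _+_ (ε-ᵀ F 𝐁 (∁ Y) X) (ε-ᵀ F 𝐑 Y (∁ X)))) boundary≤ν)
  where
  0≤δ = ℚ.<⇒≤ 0<δ
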